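{- Let $t\in\mathbb{N}$ and $d\geq 2$, and consider $d$-neighbour bootstrap percolation on $\mathbb{Z}^d$ with an arbitrary initially infected set. Suppose that the origin is protected. Then $|P(S_t)|\geq\ell_t=\sum_{i=0}^t\binom{d}{i}$; in particular, if $t\geq d$ then $S_t$ contains at least $2^d$ protected vertices. Moreover, $|P(B_t)|\geq m_t=\sum_{r=0}^t\sum_{j=0}^r\binom{d}{j}$.
   Context: In $d$-neighbour bootstrap percolation on $\mathbb{Z}^d$ (vertices adjacent iff at $\ell_1$ distance $1$) with initially infected set $A$, $A_0=A$ and $A_{s+1}=A_s\cup\{v:|N(v)\cap A_s|\geq d\}$. $\|x\|$ is the $\ell_1$ norm, $B_t=\{y:\|y\|\leq t\}$, $S_r=\{y:\|y\|=r\}$. For fixed $t$, $x\in B_t$ is protected if it is not in $A_{t-\|x\|}$; $P(X)$ denotes the set of protected sites in $X\subseteq B_t$. $\binom{d}{j}=0$ for $j>d$. -}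

module Defs where

open import Data.Nat using (ℕ; zero; suc; _+_; _∸_; _≤ᵇ_)
open import Data.Nat.Combinatorics using (_C_)
open import Data.Integer using (ℤ; ∣_∣; _-_) renaming (_+_ to _+ℤ_; suc to sucℤ; pred to predℤ)
open import Data.Fin using (Fin; zero; suc)
open import Data.Vec using (Vec; []; _∷_; updateAt)
open import Data.Bool using (Bool; true; false; _∨_; if_then_else_)
open import Data.List using (List; length)
open import Data.List.Relation.Unary.All using (All)
open import Data.List.Relation.Unary.Unique.Propositional using (Unique)
open import Data.Product using (Σ; _×_)
open import Data.Nat using (_≤_)
open import Relation.Binary.PropositionalEquality using (_≡_)

Point : ℕ → Set
Point d = Vec ℤ d

‖_‖ : ∀ {d} → Point d → ℕ
‖ [] ‖ = 0
‖ x ∷ xs ‖ = ∣ x ∣ + ‖ xs ‖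

plusE minusE : ∀ {d} → Fin d → Point d → Point d
plusE i v = updateAt v i sucℤ
minusE i v = updateAt v i predℤ

ΣFin : ∀ {d} → (Fin d → ℕ) → ℕ
ΣFin {zero} f = 0
ΣFin {suc d} f = f zero + ΣFin (λ i → f (suc i))

b2n : Bool → ℕ
b2n true = 1
b2n false = 0

nbrCount : ∀ {d} → (Point d → Bool) → Point d → ℕ
nbrCount S v = ΣFin (λ i → b2n (S (plusE i v)) + b2n (S (minusE i v)))

infected : ∀ {d} → (Point d → Bool) → ℕ → Point d → Bool
infected A zero v = A v
infected {d} A (suc s) v = infected A s v ∨ (d ≤ᵇ nbrCount (infected A s) v)

Protected : ∀ {d} → (Point d → Bool) → ℕ → Point d → Set
Protected A t x = (‖ x ‖ ≤ t) × (infected A (t ∸ ‖ x ‖) x ≡ false)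

AtLeastProtected : ∀ {d} → (Point d → Bool) → ℕ → (Point d → Set) → ℕ → Set
AtLeastProtected {d} A t X n =
  Σ (List (Point d)) λ xs →
    Unique xs × All (λ x → X x × Protected A t x) xs × (n ≤ length xs)

InSphere : ∀ {d} → ℕ → Point d → Set
InSphere r x = ‖ x ‖ ≡ r

InBall : ∀ {d} → ℕ → Point d → Set
InBall t x = ‖ x ‖ ≤ t

Σupto : ℕ → (ℕ → ℕ) → ℕ
Σupto zero f = f 0
Σupto (suc n) f = Σupto n f + f (suc n)

ℓ : ℕ → ℕ → ℕ
ℓ d t = Σupto t (λ i → d C i)

m : ℕ → ℕ → ℕ
m d t = Σupto t (λ r → ℓ d r)

origin : ∀ {d} → Point d
origin {zero} = []
origin {suc d} = ℤ.pos 0 ∷ origin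

-- A region is a product of coordinate constraints (free, a ray pointing
-- away from the origin, or a fixed value); its root is its point closest to the
-- origin.  If the root p of a region κ is protected and ‖p‖ < t, then p has
-- fewer than d infected neighbours at time t ∸ ‖p‖ − 1, hence at least d + 1
-- clean ones.  At most one per ray and two per fixed coordinate leave κ, so a
-- clean neighbour q (protected, on the next sphere) stays inside κ as soon as κ
-- has no more fixed than free coordinates.  Splitting κ there gives disjoint
-- parts κ₁ rooted at q and κ₀ still rooted at p, and induction over the levels
-- of both parts gives, by Pascal's rule, three bounds on the number of
-- protected points on level s of κ:
--   cone     ≥ (m choose s)      if κ has m more free than fixed coordinates;
--   cutCone  ≥ (m+1 choose s)    if moreover no free coordinate has such a q;
--   sphere   ≥ ℓ n s             if κ has n free and no fixed coordinates.  The
-- corollary applies sphere to the whole space rooted at the origin and adds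
-- up the spheres of the ball.

module Submission where

open import Defs
open import Data.Nat using (ℕ; zero; suc; _+_; _*_; _∸_; _≤_; _<_; _^_; z≤n; s≤s; _<?_; _≤ᵇ_)
open import Data.Nat.Properties
open import Data.Nat.Combinatorics using (_C_; nCk+nC[k+1]≡[n+1]C[k+1])
open import Algebra.Properties.CommutativeSemigroup +-commutativeSemigroup using (interchange)
open import Data.Integer as ℤ using (ℤ; -_; ∣_∣; -1ℤ; 1ℤ)
  renaming (+_ to pos; suc to sucℤ; pred to predℤ)
import Data.Integer.Properties as ℤ
open import Data.Bool using (Bool; true; false; not; _∧_; _∨_; T)
import Data.Bool.Properties as Bool
open import Data.Fin using (Fin; zero; suc)
open import Data.Fin.Properties using (all?; any?)
  renaming (_≟_ to _≟ᶠ_; suc-injective to fin-suc-injective)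
open import Data.Vec using (_∷_; lookup; updateAt)
open import Data.Vec.Properties using (lookup∘updateAt; lookup∘updateAt′)
import Data.Vec.Functional as Vector
open import Data.Vec.Functional.Properties using (updateAt-updates; updateAt-minimal)
open import Data.List using (List; []; _∷_; _++_; length)
open import Data.List.Properties using (length-++)
open import Data.List.Relation.Unary.All as All using (All; []; _∷_)
import Data.List.Relation.Unary.All.Properties as All
open import Data.List.Relation.Unary.Unique.Propositional using (Unique; []; _∷_)
import Data.List.Relation.Unary.Unique.Propositional.Properties as Unique
open import Data.Product using (Σ; ∃; _×_; _,_)
open import Data.Sum using (_⊎_; inj₁; inj₂; [_,_])
open import Data.Unit using (⊤; tt)
open import Data.Empty using (⊥; ⊥-elim)
open import Function using (_∘_)
open import Relation.Nullary using (¬_; Dec; yes; no; does)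
open import Relation.Nullary.Decidable using (dec-true; _×-dec_)
open import Relation.Binary.PropositionalEquality
  using (_≡_; _≢_; refl; sym; trans; cong; cong₂; subst; subst₂; module ≡-Reasoning)

ΣFin-cong : ∀ {n} {f g : Fin n → ℕ} → (∀ i → f i ≡ g i) → ΣFin f ≡ ΣFin g
ΣFin-cong {zero}  _ = refl
ΣFin-cong {suc n} e = cong₂ _+_ (e zero) (ΣFin-cong (e ∘ suc))

ΣFin-+ : ∀ {n} (f g : Fin n → ℕ) → ΣFin (λ i → f i + g i) ≡ ΣFin f + ΣFin g
ΣFin-+ {zero}  f g = refl
ΣFin-+ {suc n} f g = trans (cong (f zero + g zero +_) (ΣFin-+ (f ∘ suc) (g ∘ suc)))
                           (interchange (f zero) (g zero) (ΣFin (f ∘ suc)) (ΣFin (g ∘ suc)))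

ΣFin-mono : ∀ {n} {f g : Fin n → ℕ} → (∀ i → f i ≤ g i) → ΣFin f ≤ ΣFin g
ΣFin-mono {zero}  _ = z≤n
ΣFin-mono {suc n} h = +-mono-≤ (h zero) (ΣFin-mono (h ∘ suc))

ΣFin-const : ∀ {n} k → ΣFin {n} (λ _ → k) ≡ n * k
ΣFin-const {zero}  k = refl
ΣFin-const {suc n} k = cong (k +_) (ΣFin-const {n} k)

ΣFin-term : ∀ {n} (f : Fin n → ℕ) i → f i ≤ ΣFin f
ΣFin-term f zero    = m≤m+n (f zero) _
ΣFin-term f (suc i) = ≤-trans (ΣFin-term (f ∘ suc) i) (m≤n+m _ (f zero))

ΣFin-positive : ∀ {n} (f : Fin n → ℕ) → 0 < ΣFin f → ∃ λ i → 0 < f i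
ΣFin-positive {zero}  f ()
ΣFin-positive {suc n} f h with f zero in e
... | suc _ = zero , subst (0 <_) (sym e) (s≤s z≤n)
... | zero with ΣFin-positive (f ∘ suc) h
...   | i , fi>0 = suc i , fi>0

ΣFin-update : ∀ {n} (g g′ : Fin n → ℕ) i → (∀ j → j ≢ i → g′ j ≡ g j) →
              ΣFin g′ + g i ≡ ΣFin g + g′ i
ΣFin-update g g′ zero same = begin
  g′ zero + ΣFin (g′ ∘ suc) + g zero  ≡⟨ cong (λ x → g′ zero + x + g zero) rest ⟩
  g′ zero + ΣFin (g ∘ suc) + g zero   ≡⟨ +-comm (g′ zero + _) (g zero) ⟩
  g zero + (g′ zero + ΣFin (g ∘ suc)) ≡⟨ cong (g zero +_) (+-comm (g′ zero) _) ⟩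
  g zero + (ΣFin (g ∘ suc) + g′ zero) ≡⟨ +-assoc (g zero) _ _ ⟨
  g zero + ΣFin (g ∘ suc) + g′ zero   ∎
  where
  open ≡-Reasoning
  rest : ΣFin (g′ ∘ suc) ≡ ΣFin (g ∘ suc)
  rest = ΣFin-cong λ j → same (suc j) λ ()
ΣFin-update g g′ (suc i) same = begin
  g′ zero + ΣFin (g′ ∘ suc) + g (suc i)   ≡⟨ +-assoc (g′ zero) _ _ ⟩
  g′ zero + (ΣFin (g′ ∘ suc) + g (suc i)) ≡⟨ cong₂ _+_ (same zero λ ()) rest ⟩
  g zero + (ΣFin (g ∘ suc) + g′ (suc i))  ≡⟨ +-assoc (g zero) _ _ ⟨
  g zero + ΣFin (g ∘ suc) + g′ (suc i)    ∎
  where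
  open ≡-Reasoning
  rest : ΣFin (g′ ∘ suc) + g (suc i) ≡ ΣFin (g ∘ suc) + g′ (suc i)
  rest = ΣFin-update (g ∘ suc) (g′ ∘ suc) i λ j j≢i → same (suc j) (j≢i ∘ fin-suc-injective)

-- P holds at n or more distinct points; AtLeastProtected A t X n unfolds to
-- AtLeast (λ x → X x × Protected A t x) n.
AtLeast : ∀ {d} → (Point d → Set) → ℕ → Set
AtLeast {d} P n = Σ (List (Point d)) λ xs → Unique xs × All P xs × n ≤ length xs

module _ {d : ℕ} {P : Point d → Set} where

  atLeast-map : ∀ {Q : Point d → Set} → (∀ {x} → P x → Q x) → ∀ {n} →
                AtLeast P n → AtLeast Q n
  atLeast-map f (xs , u , ps , n≤) = xs , u , All.map f ps , n≤

  atLeast-weaken : ∀ {k n} → k ≤ n → AtLeast P n → AtLeast P k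
  atLeast-weaken k≤n (xs , u , ps , n≤) = xs , u , ps , ≤-trans k≤n n≤

  atLeast-zero : AtLeast P 0
  atLeast-zero = [] , [] , [] , z≤n

  atLeast-one : ∀ {x} → P x → AtLeast P 1
  atLeast-one px = _ ∷ [] , [] ∷ [] , px ∷ [] , ≤-refl

  atLeast-union : ∀ {Q : Point d → Set} → (∀ {x} → P x → Q x → ⊥) → ∀ {n k} →
                  AtLeast P n → AtLeast Q k → AtLeast (λ x → P x ⊎ Q x) (n + k)
  atLeast-union disjoint (xs , u , ps , n≤) (ys , v , qs , k≤) =
    xs ++ ys ,
    Unique.++⁺ u v (λ (x∈xs , x∈ys) → disjoint (All.lookup ps x∈xs) (All.lookup qs x∈ys)) ,
    All.++⁺ (All.map inj₁ ps) (All.map inj₂ qs) ,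
    subst (_ ≤_) (sym (length-++ xs)) (+-mono-≤ n≤ k≤)

-- Points on distinct spheres are distinct, so sphere counts add up to ball counts.
spheres⇒ball : ∀ {d} {P : Point d → Set} (k : ℕ → ℕ) t →
               (∀ r → r ≤ t → AtLeast (λ x → ‖ x ‖ ≡ r × P x) (k r)) →
               ∀ r → r ≤ t → AtLeast (λ x → ‖ x ‖ ≤ r × P x) (Σupto r k)
spheres⇒ball k t onSphere zero    r≤t =
  atLeast-map (λ (e , px) → ≤-reflexive e , px) (onSphere zero r≤t)
spheres⇒ball k t onSphere (suc r) r<t =
  atLeast-map [ (λ (le , px) → m≤n⇒m≤1+n le , px) , (λ (e , px) → ≤-reflexive e , px) ]
    (atLeast-union (λ (le , _) (e , _) → 1+n≰n (subst (_≤ r) e le))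
      (spheres⇒ball k t onSphere r (<⇒≤ r<t)) (onSphere (suc r) r<t))

C-step : ∀ m s → m C s ≤ suc m C s
C-step m zero    = ≤-refl
C-step m (suc s) = ≤-trans (m≤n+m _ (m C s)) (≤-reflexive (nCk+nC[k+1]≡[n+1]C[k+1] m s))

C-mono : ∀ s {c m} → c ≤ m → c C s ≤ m C s
C-mono s {m = zero}  z≤n = ≤-refl
C-mono s {m = suc m} c≤1+m with m≤n⇒m<n∨m≡n c≤1+m
... | inj₁ (s≤s c≤m) = ≤-trans (C-mono s c≤m) (C-step m s)
... | inj₂ refl      = ≤-refl

ℓ-pascal : ∀ n s → ℓ n s + ℓ n (suc s) ≡ ℓ (suc n) (suc s)
ℓ-pascal n zero    = cong suc (nCk+nC[k+1]≡[n+1]C[k+1] n 0)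
ℓ-pascal n (suc s) =
  trans (interchange (ℓ n s) (n C suc s) (ℓ n (suc s)) (n C suc (suc s)))
        (cong₂ _+_ (ℓ-pascal n s) (nCk+nC[k+1]≡[n+1]C[k+1] n (suc s)))

ℓ-positive : ∀ n s → 1 ≤ ℓ n s
ℓ-positive n zero    = ≤-refl
ℓ-positive n (suc s) = ≤-trans (ℓ-positive n s) (m≤m+n _ _)

-- Once s ≥ n the row sum is complete: 2^n ≤ ℓ n s.
2^n≤ℓ : ∀ {n s} → n ≤ s → 2 ^ n ≤ ℓ n s
2^n≤ℓ {zero}  {s}     _         = ℓ-positive 0 s
2^n≤ℓ {suc n} {suc s} (s≤s n≤s) = begin
  2 ^ n + (2 ^ n + 0)     ≡⟨ cong (2 ^ n +_) (+-identityʳ (2 ^ n)) ⟩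
  2 ^ n + 2 ^ n           ≤⟨ +-mono-≤ (2^n≤ℓ n≤s) (2^n≤ℓ (m≤n⇒m≤1+n n≤s)) ⟩
  ℓ n s + ℓ n (suc s)     ≡⟨ ℓ-pascal n s ⟩
  ℓ (suc n) (suc s)       ∎
  where open ≤-Reasoning

step : Bool → ℤ → ℤ
step true  = sucℤ
step false = predℤ

-- A coordinate read in direction b, so that a step in direction b increases it.
orient : Bool → ℤ → ℤ
orient true  v = v
orient false v = - v

orient-step : ∀ b v → orient b (step b v) ≡ sucℤ (orient b v)
orient-step true  v = refl
orient-step false v = ℤ.neg-distrib-+ -1ℤ v

orient-stepBack : ∀ b v → orient b (step (not b) v) ≡ predℤ (orient b v)
orient-stepBack true  v = refl
orient-stepBack false v = ℤ.neg-distrib-+ 1ℤ v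

orient-not : ∀ b v → orient (not b) v ≡ - orient b v
orient-not true  v = refl
orient-not false v = sym (ℤ.neg-involutive v)

∣orient∣ : ∀ b v → ∣ orient b v ∣ ≡ ∣ v ∣
∣orient∣ true  v = refl
∣orient∣ false v = ℤ.∣-i∣≡∣i∣ v

step-moves : ∀ b v → step b v ≢ v
step-moves true  v e = ℤ.i≢suc[i] (sym e)
step-moves false v e = ℤ.i≢suc[i] (trans (sym (ℤ.suc-pred v)) (cong sucℤ e))

-- The constraints that regions impose on a single coordinate: none, a ray
-- { v | a ≤ orient b v } pointing away from the origin, or a single value.
data Constraint : Set where
  free  : Constraint
  ray   : Bool → ℕ → Constraint
  fixed : ℤ → Constraint

Sat : Constraint → ℤ → Set
Sat free      v = ⊤
Sat (ray b a) v = pos a ℤ.≤ orient b v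
Sat (fixed z) v = v ≡ z

sat? : ∀ c v → Dec (Sat c v)
sat? free      v = yes tt
sat? (ray b a) v = pos a ℤ.≤? orient b v
sat? (fixed z) v = v ℤ.≟ z

-- The value of a constraint closest to the origin.
IsRoot : Constraint → ℤ → Set
IsRoot free      v = v ≡ pos 0
IsRoot (ray b a) v = orient b v ≡ pos a
IsRoot (fixed z) v = v ≡ z

root⇒sat : ∀ c {v} → IsRoot c v → Sat c v
root⇒sat free      _ = tt
root⇒sat (ray b a) r = ℤ.≤-reflexive (sym r)
root⇒sat (fixed z) r = r

free? : ∀ c → Dec (c ≡ free)
free? free      = yes refl
free? (ray _ _) = no λ ()
free? (fixed _) = no λ ()

isFree isFixed : Constraint → ℕ
isFree free = 1
isFree _    = 0
isFixed (fixed _) = 1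
isFixed _         = 0

-- How many of the two neighbours of the root leave the constraint.
lost : Constraint → ℕ
lost free      = 0
lost (ray _ _) = 1
lost (fixed _) = 2

lost+isFree : ∀ c → lost c + isFree c ≡ 1 + isFixed c
lost+isFree free      = refl
lost+isFree (ray _ _) = refl
lost+isFree (fixed _) = refl

ray-outward : ∀ b a {v} → IsRoot (ray b a) v → Sat (ray b a) (step b v)
ray-outward b a {v} r =
  subst (pos a ℤ.≤_) (sym (trans (orient-step b v) (cong sucℤ r))) (ℤ.i≤suc[i] (pos a))

-- Splitting a constraint c at its root: a free coordinate is cut into two
-- opposite rays, a ray into its root value and the ray one step further out.
data Shape : Constraint → Constraint → Constraint → Set where
  halving : ∀ {b a b′ a′} → Shape free (ray b a) (ray b′ a′)
  cutting : ∀ {b a a′ z} → Shape (ray b a) (ray b a′) (fixed z)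

ray≢free : ∀ {b a} → ray b a ≢ free
ray≢free ()

inner≢free : ∀ {c c₁ c₀} → Shape c c₁ c₀ → c₀ ≢ free
inner≢free halving ()
inner≢free cutting ()

record CoordSplit (c : Constraint) (v : ℤ) (b : Bool) : Set where
  field
    c₁ c₀    : Constraint
    shape    : Shape c c₁ c₀
    root₁    : IsRoot c₁ (step b v)
    root₀    : IsRoot c₀ v
    outward  : ∣ step b v ∣ ≡ suc ∣ v ∣
    sub₁     : ∀ {x} → Sat c₁ x → Sat c x
    sub₀     : ∀ {x} → Sat c₀ x → Sat c x
    disjoint : ∀ {x} → Sat c₁ x → Sat c₀ x → ⊥

opposite-rays : ∀ b {x} → Sat (ray b 1) x → Sat (ray (not b) 0) x → ⊥
opposite-rays b {x} h₁ h₀ = apart (orient b x) h₁ (subst (pos 0 ℤ.≤_) (orient-not b x) h₀)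
  where
  apart : ∀ y → pos 1 ℤ.≤ y → pos 0 ℤ.≤ - y → ⊥
  apart (pos zero)    (ℤ.+≤+ ()) _
  apart (pos (suc n)) _          ()

-- A ray can only be left inward and a fixed value not at all, so the step
-- b is outward and the split exists.
coordSplit : ∀ c b {v} → IsRoot c v → Sat c (step b v) → CoordSplit c v b
coordSplit free b refl _ = record
  { c₁ = ray b 1 ; c₀ = ray (not b) 0 ; shape = halving
  ; root₁ = unit-root b ; root₀ = zero-root b ; outward = unit-step b
  ; sub₁ = λ _ → tt ; sub₀ = λ _ → tt ; disjoint = opposite-rays b }
  where
  unit-root : ∀ b → IsRoot (ray b 1) (step b (pos 0))
  unit-root true  = refl
  unit-root false = refl
  zero-root : ∀ b → IsRoot (ray (not b) 0) (pos 0)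
  zero-root true  = refl
  zero-root false = refl
  unit-step : ∀ b → ∣ step b (pos 0) ∣ ≡ 1
  unit-step true  = refl
  unit-step false = refl
coordSplit (ray b′ a) b {v} r s with b Bool.≟ b′
... | no b≢b′ = ⊥-elim (ℤ.<-irrefl refl (ℤ.i≤pred[j]⇒i<j inward))
  where
  inward : pos a ℤ.≤ predℤ (pos a)
  inward = subst (pos a ℤ.≤_)
             (trans (cong (λ b → orient b′ (step b v)) (Bool.¬-not b≢b′))
                    (trans (orient-stepBack b′ v) (cong predℤ r))) s
... | yes refl = record
  { c₁ = ray b (suc a) ; c₀ = fixed v ; shape = cutting
  ; root₁ = trans (orient-step b v) (cong sucℤ r) ; root₀ = refl ; outward = outward
  ; sub₁ = ℤ.≤-trans (ℤ.i≤suc[i] (pos a)) ; sub₀ = λ { refl → ℤ.≤-reflexive (sym r) }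
  ; disjoint = λ { h refl → 1+n≰n (ℤ.drop‿+≤+ (subst (pos (suc a) ℤ.≤_) r h)) } }
  where
  open ≡-Reasoning
  outward : ∣ step b v ∣ ≡ suc ∣ v ∣
  outward = begin
    ∣ step b v ∣            ≡⟨ ∣orient∣ b (step b v) ⟨
    ∣ orient b (step b v) ∣ ≡⟨ cong ∣_∣ (trans (orient-step b v) (cong sucℤ r)) ⟩
    suc a                   ≡⟨ cong (suc ∘ ∣_∣) r ⟨
    suc ∣ orient b v ∣      ≡⟨ cong suc (∣orient∣ b v) ⟩
    suc ∣ v ∣               ∎
coordSplit (fixed z) b refl s = ⊥-elim (step-moves b z s)

norm-update : ∀ {d} (v : Point d) i (g : ℤ → ℤ) →
              ‖ updateAt v i g ‖ + ∣ lookup v i ∣ ≡ ‖ v ‖ + ∣ g (lookup v i) ∣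
norm-update (x ∷ xs) zero g = begin
  ∣ g x ∣ + ‖ xs ‖ + ∣ x ∣   ≡⟨ +-assoc (∣ g x ∣) _ _ ⟩
  ∣ g x ∣ + (‖ xs ‖ + ∣ x ∣) ≡⟨ +-comm (∣ g x ∣) _ ⟩
  ‖ xs ‖ + ∣ x ∣ + ∣ g x ∣   ≡⟨ cong (_+ ∣ g x ∣) (+-comm (‖ xs ‖) _) ⟩
  ∣ x ∣ + ‖ xs ‖ + ∣ g x ∣   ∎
  where open ≡-Reasoning
norm-update (x ∷ xs) (suc i) g =
  trans (+-assoc (∣ x ∣) _ _)
        (trans (cong (∣ x ∣ +_) (norm-update xs i g)) (sym (+-assoc (∣ x ∣) _ _)))

‖origin‖ : ∀ {d} → ‖ origin {d} ‖ ≡ 0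
‖origin‖ {zero}  = refl
‖origin‖ {suc d} = ‖origin‖ {d}

lookup-origin : ∀ {d} (i : Fin d) → lookup origin i ≡ pos 0
lookup-origin zero    = refl
lookup-origin (suc i) = lookup-origin i

∸-unfold : ∀ {a t} → a < t → t ∸ a ≡ suc (t ∸ suc a)
∸-unfold {zero}  {suc t} _         = refl
∸-unfold {suc a} {suc t} (s≤s a<t) = ∸-unfold a<t

b2n≤1 : ∀ b → b2n b ≤ 1
b2n≤1 true  = ≤-refl
b2n≤1 false = z≤n

∨-false : ∀ x {y} → x ∨ y ≡ false → y ≡ false
∨-false false e = e

≤ᵇ-false : ∀ {m n} → (m ≤ᵇ n) ≡ false → n < m
≤ᵇ-false e = ≰⇒> λ m≤n → subst T e (≤⇒≤ᵇ m≤n)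

b2n-not : ∀ x → b2n (not x) + b2n x ≡ 1
b2n-not true  = refl
b2n-not false = refl

b2n-test : ∀ {P : Set} (P? : Dec P) → P → ∀ y → b2n (does P? ∧ y) ≡ b2n y
b2n-test P? p y = cong (λ x → b2n (x ∧ y)) (dec-true P? p)

b2n-test-mono : ∀ {P Q : Set} (P? : Dec P) (Q? : Dec Q) → (P → Q) → ∀ y →
                b2n (does P? ∧ y) ≤ b2n (does Q? ∧ y)
b2n-test-mono (yes p) Q? P⇒Q y = ≤-reflexive (sym (b2n-test Q? (P⇒Q p) y))
b2n-test-mono (no _)  Q? P⇒Q y = z≤n

b2n-test-positive : ∀ {P : Set} (P? : Dec P) y → 0 < b2n (does P? ∧ not y) → P × y ≡ false
b2n-test-positive (yes p) false _ = p , refl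

pairSum : (Bool → ℕ) → ℕ
pairSum f = f true + f false

pairSum-positive : ∀ (f : Bool → ℕ) → 0 < pairSum f → ∃ λ b → 0 < f b
pairSum-positive f h with f true in e
... | suc _ = true , subst (0 <_) (sym e) (s≤s z≤n)
... | zero  = false , h

pairSum-one-side : ∀ {f g : Bool → ℕ} b → f b ≤ g b → (∀ b′ → f b′ ≤ 1) →
                   pairSum f ≤ pairSum g + 1
pairSum-one-side {f} {g} true  f≤g f≤1 =
  ≤-trans (+-mono-≤ f≤g (f≤1 false)) (+-monoˡ-≤ 1 (m≤m+n (g true) (g false)))
pairSum-one-side {f} {g} false f≤g f≤1 = begin
  f true + f false ≤⟨ +-mono-≤ (f≤1 true) f≤g ⟩
  1 + g false      ≡⟨ +-comm 1 (g false) ⟩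
  g false + 1      ≤⟨ +-monoˡ-≤ 1 (m≤n+m (g false) (g true)) ⟩
  pairSum g + 1    ∎
  where open ≤-Reasoning

module Core {d : ℕ} (t : ℕ) (A : Point d → Bool) where

  Region : Set
  Region = Fin d → Constraint

  InRegion : Region → Point d → Set
  InRegion κ x = ∀ j → Sat (κ j) (lookup x j)

  inRegion? : ∀ κ x → Dec (InRegion κ x)
  inRegion? κ x = all? (λ j → sat? (κ j) (lookup x j))

  RootOf : Region → Point d → Set
  RootOf κ p = ∀ j → IsRoot (κ j) (lookup p j)

  nF fF : Region → ℕ
  nF κ = ΣFin (isFree ∘ κ)
  fF κ = ΣFin (isFixed ∘ κ)

  Counts : Region → ℕ → ℕ → Set
  Counts κ n f = nF κ ≡ n × fF κ ≡ f

  upd : Region → Fin d → Constraint → Region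
  upd κ i c = Vector.updateAt κ i (λ _ → c)

  upd-at : ∀ κ i c → upd κ i c i ≡ c
  upd-at κ i c = updateAt-updates i κ

  upd-off : ∀ κ {i j} c → j ≢ i → upd κ i c j ≡ κ j
  upd-off κ {i} {j} c j≢i = updateAt-minimal j i κ j≢i

  Prot : Point d → Set
  Prot x = infected A (t ∸ ‖ x ‖) x ≡ false

  -- A neighbour of p one sphere further out is protected iff it is clean,
  -- i.e. uninfected at time next p.  nbr p i b is the neighbour in coordinate i, direction b.
  next : Point d → ℕ
  next p = t ∸ suc ‖ p ‖

  nbr : Point d → Fin d → Bool → Point d
  nbr p i b = updateAt p i (step b)

  clean : Point d → Point d → Bool
  clean p q = not (infected A (next p) q)

  cleanNbrs : Point d → Fin d → ℕ
  cleanNbrs p i = pairSum λ b → b2n (clean p (nbr p i b))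

  cleanInDir : Region → Point d → Fin d → Bool → ℕ
  cleanInDir κ p i b = b2n (does (inRegion? κ (nbr p i b)) ∧ clean p (nbr p i b))

  cleanIn : Region → Point d → Fin d → ℕ
  cleanIn κ p i = pairSum (cleanInDir κ p i)

  nbr-inside : ∀ {κ p} i b → InRegion κ p → Sat (κ i) (step b (lookup p i)) →
               InRegion κ (nbr p i b)
  nbr-inside {κ} {p} i b p∈κ s j with j ≟ᶠ i
  ... | yes refl = subst (Sat (κ i)) (sym (lookup∘updateAt i p)) s
  ... | no j≢i   = subst (Sat (κ j)) (sym (lookup∘updateAt′ j i j≢i p)) (p∈κ j)

  -- A protected point p with ‖p‖ < t has fewer than d infected neighbours at
  -- time next p (or it would be infected at time t ∸ ‖p‖), so at least d + 1 of
  -- its 2d neighbours are clean.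
  manyClean : ∀ p → Prot p → ‖ p ‖ < t → suc d ≤ ΣFin (cleanNbrs p)
  manyClean p prot ‖p‖<t = +-cancelʳ-≤ N (suc d) _ (begin
    suc d + N              ≡⟨ +-suc d N ⟨
    d + suc N              ≤⟨ +-monoʳ-≤ d few ⟩
    d + d                  ≡⟨ all-neighbours ⟨
    ΣFin (cleanNbrs p) + N ∎)
    where
    open ≤-Reasoning
    infectedNbrs : Fin d → ℕ
    infectedNbrs i = pairSum λ b → b2n (infected A (next p) (nbr p i b))
    N : ℕ
    N = nbrCount (infected A (next p)) p
    few : N < d
    few = ≤ᵇ-false (∨-false (infected A (next p) p)
                            (subst (λ s → infected A s p ≡ false) (∸-unfold ‖p‖<t) prot))
    both : ∀ i → cleanNbrs p i + infectedNbrs i ≡ 1 + 1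
    both i = trans (interchange (b2n (clean p (nbr p i true))) _ _ _)
                   (cong₂ _+_ (b2n-not (infected A (next p) (nbr p i true)))
                              (b2n-not (infected A (next p) (nbr p i false))))
    ones : ΣFin {d} (λ _ → 1) ≡ d
    ones = trans (ΣFin-const {d} 1) (*-identityʳ d)
    all-neighbours : ΣFin (cleanNbrs p) + N ≡ d + d
    all-neighbours = begin-equality
      ΣFin (cleanNbrs p) + ΣFin infectedNbrs   ≡⟨ ΣFin-+ (cleanNbrs p) infectedNbrs ⟨
      ΣFin (λ i → cleanNbrs p i + infectedNbrs i) ≡⟨ ΣFin-cong both ⟩
      ΣFin {d} (λ _ → 1 + 1)                   ≡⟨ ΣFin-+ {d} (λ _ → 1) (λ _ → 1) ⟩
      ΣFin {d} (λ _ → 1) + ΣFin {d} (λ _ → 1)  ≡⟨ cong₂ _+_ ones ones ⟩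
      d + d                                    ∎

  lostBound : ∀ κ p i → RootOf κ p → cleanNbrs p i ≤ cleanIn κ p i + lost (κ i)
  lostBound κ p i root = bound (κ i) refl (root i)
    where
    p∈κ : InRegion κ p
    p∈κ j = root⇒sat (κ j) (root j)
    inside : ∀ {c} b → κ i ≡ c → Sat c (step b (lookup p i)) →
             b2n (clean p (nbr p i b)) ≡ cleanInDir κ p i b
    inside b refl s =
      sym (b2n-test (inRegion? κ (nbr p i b)) (nbr-inside {κ} {p} i b p∈κ s) _)
    atMostOne : ∀ b → b2n (clean p (nbr p i b)) ≤ 1
    atMostOne b = b2n≤1 (clean p (nbr p i b))
    bound : ∀ c → κ i ≡ c → IsRoot c (lookup p i) → cleanNbrs p i ≤ cleanIn κ p i + lost c
    bound free      e _ = ≤-reflexive (trans (cong₂ _+_ (inside true e tt) (inside false e tt))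
                                             (sym (+-identityʳ _)))
    bound (ray b a) e r = pairSum-one-side {g = cleanInDir κ p i} b
                            (≤-reflexive (inside b e (ray-outward b a r))) atMostOne
    bound (fixed z) e _ = ≤-trans (+-mono-≤ (atMostOne true) (atMostOne false)) (m≤n+m 2 _)

  -- Each coordinate loses 1 − (free) + (fixed) clean neighbours, so summing
  -- lostBound, a region rooted at a protected p keeps more than nF κ − fF κ of them.
  cleanInside : ∀ κ p → RootOf κ p → Prot p → ‖ p ‖ < t →
                suc (nF κ) ≤ ΣFin (cleanIn κ p) + fF κ
  cleanInside κ p root prot ‖p‖<t = +-cancelʳ-≤ d _ _ (begin
    suc (nF κ) + d                   ≡⟨ cong suc (+-comm (nF κ) d) ⟩
    suc d + nF κ                     ≤⟨ +-monoˡ-≤ (nF κ) clean≤ ⟩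
    ΣFin (λ i → X i + lost (κ i)) + nF κ ≡⟨ cong (_+ nF κ) (ΣFin-+ X (lost ∘ κ)) ⟩
    ΣFin X + L + nF κ                ≡⟨ +-assoc (ΣFin X) L (nF κ) ⟩
    ΣFin X + (L + nF κ)              ≡⟨ cong (ΣFin X +_) lostTotal ⟩
    ΣFin X + (d + fF κ)              ≡⟨ cong (ΣFin X +_) (+-comm d (fF κ)) ⟩
    ΣFin X + (fF κ + d)              ≡⟨ +-assoc (ΣFin X) (fF κ) d ⟨
    ΣFin X + fF κ + d                ∎)
    where
    open ≤-Reasoning
    X : Fin d → ℕ
    X = cleanIn κ p
    L : ℕ
    L = ΣFin (lost ∘ κ)
    ones : ΣFin {d} (λ _ → 1) ≡ d
    ones = trans (ΣFin-const {d} 1) (*-identityʳ d)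
    clean≤ : suc d ≤ ΣFin (λ i → X i + lost (κ i))
    clean≤ = ≤-trans (manyClean p prot ‖p‖<t) (ΣFin-mono (λ i → lostBound κ p i root))
    lostTotal : L + nF κ ≡ d + fF κ
    lostTotal = begin-equality
      L + nF κ                               ≡⟨ ΣFin-+ (lost ∘ κ) (isFree ∘ κ) ⟨
      ΣFin (λ j → lost (κ j) + isFree (κ j)) ≡⟨ ΣFin-cong (lost+isFree ∘ κ) ⟩
      ΣFin (λ j → 1 + isFixed (κ j))         ≡⟨ ΣFin-+ (λ _ → 1) (isFixed ∘ κ) ⟩
      ΣFin {d} (λ _ → 1) + fF κ              ≡⟨ cong (_+ fF κ) ones ⟩
      d + fF κ                               ∎

  record Rooted (κ : Region) (p : Point d) (s : ℕ) : Set where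
    field
      root : RootOf κ p
      prot : Prot p
      fits : ‖ p ‖ + s ≤ t

  room : ∀ {κ p s} → Rooted κ p (suc s) → ‖ p ‖ < t
  room {p = p} {s} R =
    ≤-trans (s≤s (m≤m+n ‖ p ‖ s)) (subst (_≤ t) (+-suc ‖ p ‖ s) (Rooted.fits R))

  someClean : ∀ {κ p s} → Rooted κ p (suc s) → fF κ ≤ nF κ → ∃ λ i → 0 < cleanIn κ p i
  someClean {κ} {p} R f≤n = ΣFin-positive (cleanIn κ p)
    (+-cancelʳ-≤ (fF κ) 1 _ (≤-trans (s≤s f≤n) (cleanInside κ p root prot (room R))))
    where open Rooted R

  fixed≤free : ∀ {κ n f} → Counts κ n f → f ≤ n → fF κ ≤ nF κ
  fixed≤free (n≡ , f≡) = subst₂ _≤_ (sym f≡) (sym n≡)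

  cleanNbr : ∀ κ p i → 0 < cleanIn κ p i →
             ∃ λ b → InRegion κ (nbr p i b) × infected A (next p) (nbr p i b) ≡ false
  cleanNbr κ p i h with pairSum-positive (cleanInDir κ p i) h
  ... | b , positive = b , b2n-test-positive (inRegion? κ (nbr p i b)) _ positive

  module _ (g : Constraint → ℕ) (κ : Region) (i : Fin d) {c : Constraint} (c′ : Constraint)
           (κi≡c : κ i ≡ c) where
    private
      before after : ℕ
      before = ΣFin (g ∘ κ)
      after  = ΣFin (g ∘ upd κ i c′)

    count-upd : after + g c ≡ before + g c′
    count-upd rewrite sym κi≡c =
      trans (ΣFin-update (g ∘ κ) (g ∘ upd κ i c′) i (λ j j≢i → cong g (upd-off κ c′ j≢i)))
            (cong (λ c → before + g c) (upd-at κ i c′))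

    count-same : g c ≡ g c′ → after ≡ before
    count-same same = +-cancelʳ-≡ (g c′) _ _ (trans (cong (after +_) (sym same)) count-upd)

    count-drop : g c ≡ suc (g c′) → suc after ≡ before
    count-drop drop = +-cancelʳ-≡ (g c′) _ _ (begin
      suc after + g c′   ≡⟨ +-suc after (g c′) ⟨
      after + suc (g c′) ≡⟨ cong (after +_) drop ⟨
      after + g c        ≡⟨ count-upd ⟩
      before + g c′      ∎)
      where open ≡-Reasoning

    count-grow : suc (g c) ≡ g c′ → after ≡ suc before
    count-grow grow = +-cancelʳ-≡ (g c) _ _ (begin
      after + g c        ≡⟨ count-upd ⟩
      before + g c′      ≡⟨ cong (before +_) grow ⟨
      before + suc (g c) ≡⟨ +-suc before (g c) ⟩
      suc before + g c   ∎)
      where open ≡-Reasoning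

  data Shrinks (κ κ₁ κ₀ : Region) (i : Fin d) : Set where
    halving : κ i ≡ free → (∀ {n f} → Counts κ (suc n) f → Counts κ₁ n f × Counts κ₀ n f) →
              Shrinks κ κ₁ κ₀ i
    cutting : κ i ≢ free → (∀ {n f} → Counts κ n f → Counts κ₁ n f × Counts κ₀ n (suc f)) →
              Shrinks κ κ₁ κ₀ i

  shrinks : ∀ κ i {c c₁ c₀} → κ i ≡ c → Shape c c₁ c₀ →
            Shrinks κ (upd κ i c₁) (upd κ i c₀) i
  shrinks κ i e (halving {b} {a} {b′} {a′}) = halving e λ (n≡ , f≡) →
    (suc-injective (trans (count-drop isFree κ i (ray b a) e refl) n≡) ,
     trans (count-same isFixed κ i (ray b a) e refl) f≡) ,
    (suc-injective (trans (count-drop isFree κ i (ray b′ a′) e refl) n≡) ,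
     trans (count-same isFixed κ i (ray b′ a′) e refl) f≡)
  shrinks κ i e (cutting {b} {a} {a′} {z}) = cutting (ray≢free ∘ trans (sym e)) λ (n≡ , f≡) →
    (trans (count-same isFree κ i (ray b a′) e refl) n≡ ,
     trans (count-same isFixed κ i (ray b a′) e refl) f≡) ,
    (trans (count-same isFree κ i (fixed z) e refl) n≡ ,
     trans (count-grow isFixed κ i (fixed z) e refl) (cong suc f≡))

  upd-root : ∀ {κ p x i c} → RootOf κ p → (∀ j → j ≢ i → lookup x j ≡ lookup p j) →
             IsRoot c (lookup x i) → RootOf (upd κ i c) x
  upd-root {κ} {p} {x} {i} {c} root same r j with j ≟ᶠ i
  ... | yes refl = subst (λ c′ → IsRoot c′ (lookup x i)) (sym (upd-at κ i c)) r
  ... | no j≢i   = subst (λ c′ → IsRoot c′ (lookup x j)) (sym (upd-off κ c j≢i))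
                         (subst (IsRoot (κ j)) (sym (same j j≢i)) (root j))

  upd-sub : ∀ {κ i c x} → (∀ {v} → Sat c v → Sat (κ i) v) → InRegion (upd κ i c) x →
            InRegion κ x
  upd-sub {κ} {i} {c} {x} c⊆κi x∈ j with j ≟ᶠ i
  ... | yes refl = c⊆κi (subst (λ c′ → Sat c′ (lookup x i)) (upd-at κ i c) (x∈ i))
  ... | no j≢i   = subst (λ c′ → Sat c′ (lookup x j)) (upd-off κ c j≢i) (x∈ j)

  upd-sat : ∀ {κ i c x} → InRegion (upd κ i c) x → Sat c (lookup x i)
  upd-sat {κ} {i} {c} {x} x∈ = subst (λ c′ → Sat c′ (lookup x i)) (upd-at κ i c) (x∈ i)

  record Split (κ : Region) (p : Point d) (s : ℕ) (i : Fin d) : Set where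
    field
      κ₁ κ₀    : Region
      q        : Point d
      shrink   : Shrinks κ κ₁ κ₀ i
      rooted₁  : Rooted κ₁ q s
      rooted₀  : Rooted κ₀ p (suc s)
      level    : ‖ q ‖ + s ≡ ‖ p ‖ + suc s
      sub₁     : ∀ {x} → InRegion κ₁ x → InRegion κ x
      sub₀     : ∀ {x} → InRegion κ₀ x → InRegion κ x
      disjoint : ∀ {x} → InRegion κ₁ x → InRegion κ₀ x → ⊥
      free₀    : ∀ j → κ₀ j ≡ free → κ j ≡ free

  split : ∀ {κ p s i} → Rooted κ p (suc s) → 0 < cleanIn κ p i → Split κ p s i
  split {κ} {p} {s} {i} R cleanIn>0 with cleanNbr κ p i cleanIn>0
  ... | b , q∈κ , q-clean = record
    { κ₁ = upd κ i c₁ ; κ₀ = upd κ i c₀ ; q = q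
    ; shrink = shrinks κ i refl shape
    ; rooted₁ = record
        { root = upd-root {p = p} {x = q} root (λ j j≢i → lookup∘updateAt′ j i j≢i p)
                          (subst (IsRoot c₁) (sym (lookup∘updateAt i p)) root₁)
        ; prot = subst (λ r → infected A (t ∸ r) q ≡ false) (sym norm-q) q-clean
        ; fits = subst (_≤ t) (sym level) fits }
    ; rooted₀ = record
        { root = upd-root {p = p} {x = p} root (λ _ _ → refl) root₀
        ; prot = prot
        ; fits = fits }
    ; level = level
    ; sub₁ = λ {x} → upd-sub {x = x} sub₁ ; sub₀ = λ {x} → upd-sub {x = x} sub₀
    ; disjoint = λ {x} x∈₁ x∈₀ → disjoint (upd-sat {x = x} x∈₁) (upd-sat {x = x} x∈₀)
    ; free₀ = free₀
    }
    where
    open Rooted R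
    v : ℤ
    v = lookup p i
    q : Point d
    q = nbr p i b
    open CoordSplit (coordSplit (κ i) b (root i) (subst (Sat (κ i)) (lookup∘updateAt i p) (q∈κ i)))
    norm-q : ‖ q ‖ ≡ suc ‖ p ‖
    norm-q = +-cancelʳ-≡ ∣ v ∣ _ _ (begin
      ‖ q ‖ + ∣ v ∣        ≡⟨ norm-update p i (step b) ⟩
      ‖ p ‖ + ∣ step b v ∣ ≡⟨ cong (‖ p ‖ +_) outward ⟩
      ‖ p ‖ + suc ∣ v ∣    ≡⟨ +-suc ‖ p ‖ ∣ v ∣ ⟩
      suc ‖ p ‖ + ∣ v ∣    ∎)
      where open ≡-Reasoning
    level : ‖ q ‖ + s ≡ ‖ p ‖ + suc s
    level = trans (cong (_+ s) norm-q) (sym (+-suc ‖ p ‖ s))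
    free₀ : ∀ j → upd κ i c₀ j ≡ free → κ j ≡ free
    free₀ j e with j ≟ᶠ i
    ... | yes refl = ⊥-elim (inner≢free shape (trans (sym (upd-at κ i c₀)) e))
    ... | no j≢i   = trans (sym (upd-off κ c₀ j≢i)) e

  Layer : Region → ℕ → ℕ → Set
  Layer κ L n = AtLeast (λ x → InRegion κ x × ‖ x ‖ ≡ L × Prot x) n

  layer-root : ∀ {κ p s} → Rooted κ p s → Layer κ (‖ p ‖ + 0) 1
  layer-root {κ} {p} R =
    atLeast-one {x = p} ((λ j → root⇒sat (κ j) (root j)) , sym (+-identityʳ _) , prot)
    where open Rooted R

  merge : ∀ {κ p s i n₁ n₀} (sp : Split κ p s i) → let open Split sp in
          Layer κ₁ (‖ q ‖ + s) n₁ → Layer κ₀ (‖ p ‖ + suc s) n₀ →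
          Layer κ (‖ p ‖ + suc s) (n₁ + n₀)
  merge sp layer₁ layer₀ =
    atLeast-map (λ {x} → [ (λ (x∈ , e , pr) → sub₁ {x} x∈ , trans e level , pr)
                         , (λ (x∈ , e , pr) → sub₀ {x} x∈ , e , pr) ])
      (atLeast-union (λ {x} (x∈₁ , _) (x∈₀ , _) → disjoint {x} x∈₁ x∈₀) layer₁ layer₀)
    where open Split sp

  cone : ∀ s m {f κ p} → Rooted κ p s → Counts κ (f + m) f → Layer κ (‖ p ‖ + s) (m C s)
  cone zero    m       R _ = layer-root R
  cone (suc s) zero    R _ = atLeast-zero
  cone (suc s) (suc m) {f} {κ} R (n≡ , f≡) with someClean R (fixed≤free (n≡ , f≡) (m≤m+n f (suc m)))
  ... | i , i-clean with split R i-clean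
  ... | sp with Split.shrink sp
  ... | halving _ counts =
    let (c₁ , c₀) = counts (trans n≡ (+-suc f m) , f≡) in
    subst (Layer κ _) (nCk+nC[k+1]≡[n+1]C[k+1] m s)
      (merge sp (cone s m (Split.rooted₁ sp) c₁) (cone (suc s) m (Split.rooted₀ sp) c₀))
  ... | cutting _ counts =
    let ((n₁ , f₁) , (n₀ , f₀)) = counts (n≡ , f≡) in
    subst (Layer κ _) (nCk+nC[k+1]≡[n+1]C[k+1] m s)
      (atLeast-weaken (+-monoˡ-≤ (m C suc s) (C-step m s))
        (merge sp (cone s (suc m) (Split.rooted₁ sp) (n₁ , f₁))
                  (cone (suc s) m (Split.rooted₀ sp) (trans n₀ (+-suc f m) , f₀))))

  NoFreeClean : Region → Point d → Set
  NoFreeClean κ p = ∀ j → κ j ≡ free → cleanIn κ p j ≡ 0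

  cleanIn-mono : ∀ {κ′ κ} → (∀ {x} → InRegion κ′ x → InRegion κ x) → ∀ p j →
                 cleanIn κ′ p j ≤ cleanIn κ p j
  cleanIn-mono {κ′} {κ} sub p j = +-mono-≤ (term true) (term false)
    where
    term : ∀ b → cleanInDir κ′ p j b ≤ cleanInDir κ p j b
    term b = b2n-test-mono (inRegion? κ′ (nbr p j b)) (inRegion? κ (nbr p j b))
                           (sub {nbr p j b}) (clean p (nbr p j b))

  -- The part κ₀ of a split inherits NoFreeClean: it is smaller and has no new free coordinates.
  noFreeClean₀ : ∀ {κ p s i} (sp : Split κ p s i) → NoFreeClean κ p →
                 NoFreeClean (Split.κ₀ sp) p
  noFreeClean₀ {p = p} sp none j free-j =
    n≤0⇒n≡0 (≤-trans (cleanIn-mono (λ {x} → sub₀ {x}) p j)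
                     (≤-reflexive (none j (free₀ j free-j))))
    where open Split sp

  -- Improved cone bound when NoFreeClean holds: every split is a cut, and
  -- level s contains (c choose s) protected points as long as c ≤ nF − fF + 1.
  cutCone : ∀ s c {n f κ p} → Rooted κ p s → Counts κ n f → c + f ≤ suc n → NoFreeClean κ p →
            Layer κ (‖ p ‖ + s) (c C s)
  cutCone zero    c       R _ _ _ = layer-root R
  cutCone (suc s) zero    R _ _ _ = atLeast-zero
  cutCone (suc s) (suc c) {n} {f} {κ} R counts₀ bound none
    with someClean R (fixed≤free counts₀ (m+n≤o⇒n≤o c (≤-pred bound)))
  ... | i , i-clean with split R i-clean
  ... | sp with Split.shrink sp
  ... | halving free-i _ = ⊥-elim (<⇒≢ i-clean (sym (none i free-i)))
  ... | cutting _ counts =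
    let ((n₁ , f₁) , c₀) = counts counts₀ in
    subst (Layer κ _) (nCk+nC[k+1]≡[n+1]C[k+1] c s)
      (atLeast-weaken (+-monoˡ-≤ (c C suc s) (C-mono s c≤n∸f))
        (merge sp (cone s (n ∸ f) (Split.rooted₁ sp) (trans n₁ (sym (m+[n∸m]≡n f≤n)) , f₁))
                  (cutCone (suc s) c (Split.rooted₀ sp) c₀ (subst (_≤ suc n) (sym (+-suc c f)) bound)
                           (noFreeClean₀ sp none))))
    where
    c≤n∸f : c ≤ n ∸ f
    c≤n∸f = subst (_≤ n ∸ f) (m+n∸n≡m c f) (∸-monoˡ-≤ f (≤-pred bound))
    f≤n : f ≤ n
    f≤n = m+n≤o⇒n≤o c (≤-pred bound)

  freeClean? : ∀ κ p → Dec (∃ λ j → κ j ≡ free × 0 < cleanIn κ p j)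
  freeClean? κ p = any? λ j → free? (κ j) ×-dec (0 <? cleanIn κ p j)

  noFreeClean : ∀ {κ p} → ¬ (∃ λ j → κ j ≡ free × 0 < cleanIn κ p j) → NoFreeClean κ p
  noFreeClean none j free-j = n≤0⇒n≡0 (≮⇒≥ λ positive → none (j , free-j , positive))

  free⇒nF>0 : ∀ κ j → κ j ≡ free → 0 < nF κ
  free⇒nF>0 κ j free-j =
    ≤-trans (≤-reflexive (cong isFree (sym free-j))) (ΣFin-term (isFree ∘ κ) j)

  -- Halve a free
  -- coordinate with a clean neighbour if there is one (Pascal's rule for ℓ);
  -- otherwise cut, and count the part with one fixed coordinate by cutCone.
  sphere : ∀ s n {κ p} → Rooted κ p s → Counts κ n 0 → Layer κ (‖ p ‖ + s) (ℓ n s)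
  sphere zero    n R _ = layer-root R
  sphere (suc s) n {κ} {p} R counts₀ with freeClean? κ p
  sphere (suc s) zero    {κ} R (n≡ , _) | yes (j , free-j , _) =
    ⊥-elim (<⇒≢ (free⇒nF>0 κ j free-j) (sym n≡))
  sphere (suc s) (suc n) {κ} R counts₀ | yes (j , free-j , j-clean) with split R j-clean
  ... | sp with Split.shrink sp
  ... | cutting notFree _ = ⊥-elim (notFree free-j)
  ... | halving _ counts =
    let (c₁ , c₀) = counts counts₀ in
    subst (Layer κ _) (ℓ-pascal n s)
      (merge sp (sphere s n (Split.rooted₁ sp) c₁) (sphere (suc s) n (Split.rooted₀ sp) c₀))
  sphere (suc s) n {κ} R counts₀ | no none with someClean R (fixed≤free counts₀ z≤n)
  ... | i , i-clean with split R i-clean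
  ... | sp with Split.shrink sp
  ... | halving free-i _ = ⊥-elim (none (i , free-i , i-clean))
  ... | cutting _ counts =
    let (c₁ , c₀) = counts counts₀ in
    merge sp (sphere s n (Split.rooted₁ sp) c₁)
             (cutCone (suc s) n (Split.rooted₀ sp) c₀ (≤-reflexive (+-comm n 1))
                      (noFreeClean₀ sp (noFreeClean none)))

  protectedOnSpheres : Prot origin → ∀ r → r ≤ t →
                       AtLeast (λ x → ‖ x ‖ ≡ r × Protected A t x) (ℓ d r)
  protectedOnSpheres prot₀ r r≤t =
    atLeast-map (λ (_ , on , pr) → let ‖x‖≡r = trans on level in
                                     ‖x‖≡r , subst (_≤ t) (sym ‖x‖≡r) r≤t , pr)
                (sphere r d whole-rooted whole-counts)
    where
    whole : Region
    whole _ = free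
    level : ‖ origin {d} ‖ + r ≡ r
    level = cong (_+ r) (‖origin‖ {d})
    whole-rooted : Rooted whole origin r
    whole-rooted = record { root = lookup-origin ; prot = prot₀ ; fits = subst (_≤ t) (sym level) r≤t }
    whole-counts : Counts whole d 0
    whole-counts = trans (ΣFin-const {d} 1) (*-identityʳ d) , trans (ΣFin-const {d} 0) (*-zeroʳ d)

corollary3p3 : (d t : ℕ) → 2 ≤ d → (A : Point d → Bool) →
    Protected A t (origin {d}) →
    AtLeastProtected A t (InSphere t) (ℓ d t)
    × (d ≤ t → AtLeastProtected A t (InSphere t) (2 ^ d))
    × AtLeastProtected A t (InBall t) (m d t)
corollary3p3 d t _ A (_ , origin-protected) =
  onSphere , (λ d≤t → atLeast-weaken (2^n≤ℓ d≤t) onSphere) , spheres⇒ball (ℓ d) t spheres t ≤-refl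
  where
  spheres : ∀ r → r ≤ t → AtLeast (λ x → ‖ x ‖ ≡ r × Protected A t x) (ℓ d r)
  spheres = Core.protectedOnSpheres t A origin-protected
  onSphere : AtLeastProtected A t (InSphere t) (ℓ d t)
  onSphere = spheres t ≤-refl
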